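{- Let $G$ be a finite simple graph and $v$ a vertex whose degree is not shared by any other vertex, and suppose $v$ is not ds-completable. Let $\beta_v = \{w : d_w = d_v + 1\}$. If $i$ is a vertex set with $B \setminus \beta_v \subseteq i$, then $\epsilon(v, i \cap B) \ge 1$, i.e. $v$ is adjacent to some vertex of $i \cap B$.
   Context: $d_x$ is the degree of $x$. A vertex is bad if $G$ contains a vertex of degree one less than its degree; $B$ is the set of bad vertices. A vertex $v$ is ds-completable if, for each integer $d$, the vertices having degree $d$ in $G-v$ are either all neighbours of $v$ in $G$ or all non-neighbours. $\epsilon(j,k) = \sum_{x \in j} |N(x) \cap k|$, a single vertex being identified with a singleton. -}

module Defs where

open import Data.Nat using (ℕ; _+_; _≟_; _≤_)
open import Data.Bool using (Bool; true; false; if_then_else_)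
open import Data.Fin using (Fin)
open import Data.Fin.Subset using (Subset; ∣_∣; _∈_; _∉_; _∩_; ⁅_⁆; _-_)
open import Data.Fin.Properties using (any?)
open import Data.Vec using (tabulate)
open import Data.List using (map; allFin)
open import Data.Nat.ListAction using (sum)
open import Data.Product using (∃)
open import Data.Sum using (_⊎_)
open import Relation.Nullary using (¬_; does)
open import Relation.Binary.PropositionalEquality using (_≡_)

record Graph (n : ℕ) : Set where
  field
    adj     : Fin n → Fin n → Bool
    sym     : ∀ x y → adj x y ≡ adj y x
    irrefl  : ∀ x → adj x x ≡ false

module _ {n : ℕ} (G : Graph n) where
  open Graph G

  N : Fin n → Subset n
  N x = tabulate (adj x)

  Adj : Fin n → Fin n → Set
  Adj x y = adj x y ≡ true

  deg : Fin n → ℕ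
  deg x = ∣ N x ∣

  -- degree of w in G - v (neighbours of w other than v)
  degDel : Fin n → Fin n → ℕ
  degDel v w = ∣ N w - v ∣

  B : Subset n
  B = tabulate λ x → does (any? λ y → deg y + 1 ≟ deg x)

  β : Fin n → Subset n
  β v = tabulate λ w → does (deg w ≟ deg v + 1)

  DsCompletable : Fin n → Set
  DsCompletable v = ∀ (d : ℕ) →
      (∀ w → ¬ w ≡ v → degDel v w ≡ d → Adj v w)
    ⊎ (∀ w → ¬ w ≡ v → degDel v w ≡ d → ¬ Adj v w)

  ε : Subset n → Subset n → ℕ
  ε j k = sum (map (λ x → if does (x ∈? j) then ∣ N x ∩ k ∣ else 0) (allFin n))
    where open import Data.Fin.Subset.Properties using (_∈?_)

module Submission where

-- If v is not ds-completable, some degree class of G - v contains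
-- both a neighbour w₁ of v and a non-neighbour w₂ ≠ v.  Deleting v lowers
-- the degree of w₁ by one and leaves that of w₂ unchanged, so
-- d_{w₁} = d_{w₂} + 1: hence w₁ is bad.  If w₁ were in β_v we would get
-- d_{w₂} = d_v, so w₂ = v by uniqueness of the degree of v, which is
-- impossible.  Thus w₁ ∈ B ─ β_v ⊆ i, and w₁ ∈ N(v) ∩ i ∩ B forces
-- ε(v, i ∩ B) ≥ 1.

open import Defs
open import Data.Nat using (ℕ; suc; _+_; _≤_; _≤?_; _≟_)
open import Data.Nat.Properties using (+-comm; suc-injective; ≤-refl; ≤-trans; m≤m+n; m≤n+m)
open import Data.Nat.ListAction using (sum)
open import Data.Bool using (Bool; true; false; if_then_else_)
open import Data.Fin using (Fin; zero; suc)
open import Data.Fin.Properties using (any?)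
open import Data.Fin.Subset using (Subset; _⊆_; _∩_; _─_; ⁅_⁆; _∈_; _∉_; ∣_∣; _-_; inside; outside)
open import Data.Fin.Subset.Properties using (_∈?_; x∈p∩q⁺; x∈p∧x∉q⇒x∈p─q; x∈⁅x⁆; p─⊥≡p)
open import Data.Vec using (_∷_; here; there; tabulate)
open import Data.Vec.Properties using (lookup∘tabulate; lookup⇒[]=; []=⇒lookup)
open import Data.List using (List; _∷_; map; allFin)
open import Data.List.Membership.Propositional.Properties using (∈-allFin)
import Data.List.Membership.Propositional as List
open import Data.List.Relation.Unary.Any using () renaming (here to hereₗ; there to thereₗ)
open import Data.Product using (_×_; _,_)
open import Data.Sum using (inj₁; inj₂)
open import Relation.Nullary using (¬_; does; yes; no; contradiction)
open import Relation.Nullary.Decidable using (dec-true; dec-false; decidable-stable; _×-dec_)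
open import Data.Bool.Properties using () renaming (_≟_ to _≟ᵇ_)
open import Relation.Binary.PropositionalEquality using (_≡_; refl; sym; trans; cong; subst)

∈-tabulate⁺ : ∀ {n} (f : Fin n → Bool) x → f x ≡ true → x ∈ tabulate f
∈-tabulate⁺ f x fx = lookup⇒[]= x (tabulate f) (trans (lookup∘tabulate f x) fx)

∈-tabulate⁻ : ∀ {n} (f : Fin n → Bool) x → x ∈ tabulate f → f x ≡ true
∈-tabulate⁻ f x x∈ = trans (sym (lookup∘tabulate f x)) ([]=⇒lookup x∈)

∣p-x∣-∈ : ∀ {n} (p : Subset n) x → x ∈ p → suc ∣ p - x ∣ ≡ ∣ p ∣
∣p-x∣-∈ (inside ∷ p)  zero    here      = cong suc (cong ∣_∣ (p─⊥≡p p))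
∣p-x∣-∈ (inside ∷ p)  (suc x) (there m) = cong suc (∣p-x∣-∈ p x m)
∣p-x∣-∈ (outside ∷ p) (suc x) (there m) = ∣p-x∣-∈ p x m

∣p-x∣-∉ : ∀ {n} (p : Subset n) x → x ∉ p → ∣ p - x ∣ ≡ ∣ p ∣
∣p-x∣-∉ (inside ∷ p)  zero    x∉ = contradiction here x∉
∣p-x∣-∉ (outside ∷ p) zero    x∉ = cong ∣_∣ (p─⊥≡p p)
∣p-x∣-∉ (inside ∷ p)  (suc x) x∉ = cong suc (∣p-x∣-∉ p x (λ m → x∉ (there m)))
∣p-x∣-∉ (outside ∷ p) (suc x) x∉ = ∣p-x∣-∉ p x (λ m → x∉ (there m))

∈⇒1≤∣p∣ : ∀ {n} (p : Subset n) x → x ∈ p → 1 ≤ ∣ p ∣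
∈⇒1≤∣p∣ p x x∈ = subst (1 ≤_) (∣p-x∣-∈ p x x∈) (m≤m+n 1 ∣ p - x ∣)

≤-sum-map : ∀ {A : Set} (f : A → ℕ) (xs : List A) x → x List.∈ xs → f x ≤ sum (map f xs)
≤-sum-map f (y ∷ xs) x (hereₗ refl) = m≤m+n (f y) (sum (map f xs))
≤-sum-map f (y ∷ xs) x (thereₗ m)   = ≤-trans (≤-sum-map f xs x m) (m≤n+m _ (f y))

module _ {n : ℕ} (G : Graph n) where
  open Graph G using (adj) renaming (sym to adj-sym)

  Adj⇒∈N : ∀ v w → Adj G v w → w ∈ N G v
  Adj⇒∈N v w a = ∈-tabulate⁺ (adj v) w a

  ∈N⇒Adj : ∀ v w → w ∈ N G v → Adj G v w
  ∈N⇒Adj v w m = ∈-tabulate⁻ (adj v) w m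

  Adj-sym : ∀ v w → Adj G v w → Adj G w v
  Adj-sym v w a = trans (adj-sym w v) a

  degDel-Adj : ∀ v w → Adj G v w → suc (degDel G v w) ≡ deg G w
  degDel-Adj v w a = ∣p-x∣-∈ (N G w) v (Adj⇒∈N w v (Adj-sym v w a))

  degDel-¬Adj : ∀ v w → ¬ Adj G v w → degDel G v w ≡ deg G w
  degDel-¬Adj v w ¬a = ∣p-x∣-∉ (N G w) v (λ m → ¬a (Adj-sym w v (∈N⇒Adj w v m)))

  ∈B : ∀ x y → deg G y + 1 ≡ deg G x → x ∈ B G
  ∈B x y e = ∈-tabulate⁺ _ x (dec-true (any? λ z → deg G z + 1 ≟ deg G x) (y , e))

  ∉β : ∀ v w → ¬ deg G w ≡ deg G v + 1 → w ∉ β G v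
  ∉β v w ¬e m = contradiction (trans (sym (∈-tabulate⁻ _ w m)) (dec-false (deg G w ≟ deg G v + 1) ¬e))
                              λ ()

  ε-member : ∀ j k x → x ∈ j → ∣ N G x ∩ k ∣ ≤ ε G j k
  ε-member j k x x∈ = ≤-trans contribution (≤-sum-map F (allFin n) x (∈-allFin x))
    where
      F : Fin n → ℕ
      F y = if does (y ∈? j) then ∣ N G y ∩ k ∣ else 0
      contribution : ∣ N G x ∩ k ∣ ≤ F x
      contribution = subst (λ b → ∣ N G x ∩ k ∣ ≤ (if b then ∣ N G x ∩ k ∣ else 0))
                           (sym (dec-true (x ∈? j) x∈)) ≤-refl

  -- A mixed pair for v: a neighbour w₁ and a non-neighbour w₂ ≠ v of v with
  -- the same degree in G - v.  These are exactly the obstructions to v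
  -- being ds-completable.
  Mixed : Fin n → Fin n → Fin n → Set
  Mixed v w₁ w₂ = Adj G v w₁ × ¬ w₂ ≡ v × ¬ Adj G v w₂ × degDel G v w₁ ≡ degDel G v w₂

  mixed-deg : ∀ v w₁ w₂ → Mixed v w₁ w₂ → deg G w₂ + 1 ≡ deg G w₁
  mixed-deg v w₁ w₂ (a₁ , _ , ¬a₂ , e) = trans (+-comm (deg G w₂) 1)
    (trans (cong suc (trans (sym (degDel-¬Adj v w₂ ¬a₂)) (sym e))) (degDel-Adj v w₁ a₁))

  -- Without mixed pairs v is ds-completable: in each degree class of G - v,
  -- either some vertex is a neighbour of v (then all are) or none is.
  noMixed⇒DsCompletable : ∀ v → (∀ w₁ w₂ → ¬ Mixed v w₁ w₂) → DsCompletable G v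
  noMixed⇒DsCompletable v noMixed d
    with any? (λ w → adj v w ≟ᵇ true ×-dec degDel G v w ≟ d)
  ... | yes (w₁ , a₁ , e₁) = inj₁ allAdjacent
    where
      allAdjacent : ∀ w → ¬ w ≡ v → degDel G v w ≡ d → Adj G v w
      allAdjacent w w≢v e with adj v w in a
      ... | true  = refl
      ... | false = contradiction (a₁ , w≢v , ¬Adj , trans e₁ (sym e)) (noMixed w₁ w)
        where
          ¬Adj : ¬ Adj G v w
          ¬Adj t = contradiction (trans (sym a) t) λ ()
  ... | no none = inj₂ λ w _ e a → none (w , a , e)

  -- A mixed pair puts its neighbour w₁ into N(v) ∩ i ∩ B whenever v has a
  -- unique degree and B ─ β_v ⊆ i: w₁ is bad, and w₁ ∈ β_v would give
  -- d_{w₂} = d_v, i.e. w₂ = v.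
  mixed⇒ε : ∀ v → (∀ w → deg G w ≡ deg G v → w ≡ v) →
            ∀ i → B G ─ β G v ⊆ i →
            ∀ w₁ w₂ → Mixed v w₁ w₂ → 1 ≤ ε G ⁅ v ⁆ (i ∩ B G)
  mixed⇒ε v uniq i B─β⊆i w₁ w₂ m@(a₁ , w₂≢v , _ , _) =
    ≤-trans (∈⇒1≤∣p∣ _ w₁ w₁∈) (ε-member ⁅ v ⁆ (i ∩ B G) v (x∈⁅x⁆ v))
    where
      degs : deg G w₂ + 1 ≡ deg G w₁
      degs = mixed-deg v w₁ w₂ m
      w₁∈B : w₁ ∈ B G
      w₁∈B = ∈B w₁ w₂ degs
      w₁∉β : w₁ ∉ β G v
      w₁∉β = ∉β v w₁ λ e → w₂≢v (uniq w₂ (suc-injective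
        (trans (+-comm 1 (deg G w₂)) (trans degs (trans e (+-comm (deg G v) 1))))))
      w₁∈ : w₁ ∈ N G v ∩ (i ∩ B G)
      w₁∈ = x∈p∩q⁺ (Adj⇒∈N v w₁ a₁ , x∈p∩q⁺ (B─β⊆i (x∈p∧x∉q⇒x∈p─q w₁∈B w₁∉β) , w₁∈B))

-- Since 1 ≤ ε(v, i ∩ B)
-- is decidable it suffices to refute its negation, which would exclude all
-- mixed pairs and so make v ds-completable.
corollary1 : ∀ {n : ℕ} (G : Graph n) (v : Fin n) →
    (∀ w → deg G w ≡ deg G v → w ≡ v) →
    ¬ DsCompletable G v →
    (i : Subset n) → B G ─ β G v ⊆ i →
    1 ≤ ε G ⁅ v ⁆ (i ∩ B G)
corollary1 G v uniq ¬ds i B─β⊆i =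
  decidable-stable (1 ≤? ε G ⁅ v ⁆ (i ∩ B G)) λ ¬ε →
    ¬ds (noMixed⇒DsCompletable G v λ w₁ w₂ m → ¬ε (mixed⇒ε G v uniq i B─β⊆i w₁ w₂ m))
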